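{- For every $n\in\mathbb{N}$, \[\alpha_{n,3} = \binom{n}{2} - \left\lfloor \frac{n}{2}\right\rfloor \quad\text{and}\quad \alpha_{n,4} = \binom{n}{3} - \frac12\binom{n}{2} + \frac12\left\lfloor\frac{n}{2}\right\rfloor.\]
   Context: $\mathcal{P}_{\mathrm{fin},0}(\mathbb{N}_0)$ is the monoid of finite subsets of $\mathbb{N}_0$ containing $0$ under sumset $A+B=\{a+b: a\in A, b\in B\}$, with identity $\{0\}$. An atom is an element $A\ne\{0\}$ such that $A=B+C$ with $B,C\in\mathcal{P}_{\mathrm{fin},0}(\mathbb{N}_0)$ implies $B=\{0\}$ or $C=\{0\}$; let $\mathcal{A}$ be the set of atoms. For $n,k\in\mathbb{N}$, $\mathcal{A}_{n,k}=\{A\in\mathcal{A} : \max A\le n,\ |A|=k\}$ and $\alpha_{n,k}=|\mathcal{A}_{n,k}|$. -}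

module Defs where

open import Data.Nat using (ℕ; zero; suc; _+_)
open import Data.Fin using (Fin; toℕ)
open import Data.Fin.Subset as Sub using (Subset; ∣_∣)
open import Data.Fin.Subset.Properties using (_∈?_)
open import Data.List using (List; []; _∷_; map; concatMap; filter; length; allFin)
open import Data.List.Membership.Propositional using (_∈_)
open import Data.List.Relation.Unary.Unique.Propositional using (Unique)
open import Data.Product using (Σ; _×_)
open import Data.Sum using (_⊎_)
open import Function.Bundles using (_⇔_)
open import Relation.Binary.PropositionalEquality using (_≡_)
open import Relation.Nullary using (¬_)

-- A finite subset of ℕ₀ is represented by a list of its elements
-- (duplicates / order irrelevant); sets are compared extensionally.
_≐_ : List ℕ → List ℕ → Set
A ≐ B = ∀ x → (x ∈ A) ⇔ (x ∈ B)

InP : List ℕ → Set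
InP A = 0 ∈ A

_⊕_ : List ℕ → List ℕ → List ℕ
A ⊕ B = concatMap (λ a → map (a +_) B) A

𝟎 : List ℕ
𝟎 = 0 ∷ []

IsAtom : List ℕ → Set
IsAtom A = InP A × ¬ (A ≐ 𝟎) ×
  (∀ B C → InP B → InP C → A ≐ (B ⊕ C) → (B ≐ 𝟎) ⊎ (C ≐ 𝟎))

elems : ∀ {m} → Subset m → List ℕ
elems {m} S = map toℕ (filter (_∈? S) (allFin m))

-- α n k ≡ c :  𝒜_{n,k} = { A atom : max A ≤ n, |A| = k } has exactly c elements.
-- Sets A ⊆ {0,…,n} are represented faithfully by S : Subset (suc n).
-- "has exactly c elements" = there is a duplicate-free list of length c
-- whose members are exactly the elements of 𝒜_{n,k}.
AlphaIs : ℕ → ℕ → ℕ → Set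
AlphaIs n k c = Σ (List (Subset (suc n))) λ L →
  Unique L × length L ≡ c ×
  (∀ S → (S ∈ L) ⇔ (IsAtom (elems S) × ∣ S ∣ ≡ k))

-- An atom of size 3 with maximum at most n is {0, a, b} with 0 < a < b ≤ n and b ≠ 2a, and one
-- of size 4 is {0, a, b, c} with c ≠ a + b. If A = X + Y with both summands nontrivial, the least
-- positive element a of A lies in one summand, say X; the other summand is then trapped in {0, a},
-- which forces b = 2a and, for size 4, leaves no way to reach c. Conversely {0, a, 2a} and
-- {0, a, b, a + b} are {0, a} + {0, a} and {0, a} + {0, b}.
-- Counting the increasing lists row by row: among the pairs a < b ≤ n exactly ⌊n/2⌋ have b = 2a,
-- and among the pairs a < b ≤ k exactly ⌊k/2⌋ have a + b = k + 1, so there are C(k,2) − ⌊k/2⌋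
-- atoms of size 4 with maximum k + 1; summing over k gives the second formula.
module Submission where

open import Defs
open import Data.Nat
  using (ℕ; zero; suc; pred; _+_; _*_; _∸_; _/_; _≤_; _<_; z≤n; s≤s; s≤s⁻¹; z<s; s<s; s<s⁻¹;
         _≟_; _≤?_; ⌊_/2⌋; ⌈_/2⌉)
open import Data.Nat.Properties
open import Data.Nat.Combinatorics using (_C_; nC1≡n; nCk+nC[k+1]≡[n+1]C[k+1])
open import Data.Nat.DivMod using (m/n≡1+[m∸n]/n)
open import Data.Nat.Tactic.RingSolver using (solve-∀)
open import Algebra.Properties.CommutativeSemigroup +-commutativeSemigroup
  using (xy∙z≈xz∙y; xy∙z≈x∙zy)
open import Data.Fin using (toℕ) renaming (suc to fsuc)
open import Data.Bool using (true; false)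
open import Data.Vec using ([]; _∷_)
open import Data.Fin.Subset using (Subset; ∣_∣; inside; outside)
open import Data.Fin.Subset.Properties using (_∈?_)
open import Data.List
  using (List; []; _∷_; _++_; map; filter; concatMap; length; allFin; tabulate; downFrom)
open import Data.List.Properties
  using (length-map; length-++; length-downFrom; map-∘; map-id; map-id-local; map-tabulate;
         filter-all; filter-accept; filter-reject; ∷-injectiveˡ; ∷-injectiveʳ)
open import Data.List.Membership.Propositional using (_∈_; _∉_; find; lose)
open import Data.List.Membership.Propositional.Properties
  using (∈-map⁺; ∈-map⁻; ∈-filter⁺; ∈-filter⁻; ∈-concatMap⁺; ∈-concatMap⁻;
         ∈-downFrom⁺; ∈-downFrom⁻)
open import Data.List.Relation.Binary.Disjoint.Propositional using (Disjoint)
open import Data.List.Relation.Unary.All as All using (All; []; _∷_)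
import Data.List.Relation.Unary.All.Properties as Allₚ
open import Data.List.Relation.Unary.AllPairs as AllPairs using (AllPairs; []; _∷_)
import Data.List.Relation.Unary.AllPairs.Properties as AllPairsₚ
open import Data.List.Relation.Unary.Any using (here; there; any?)
open import Data.List.Relation.Unary.Unique.Propositional using (Unique)
import Data.List.Relation.Unary.Unique.Propositional.Properties as Uniqueₚ
open import Data.Product using (Σ; ∃-syntax; ∃₂; _×_; _,_; proj₁; proj₂)
open import Data.Sum using (_⊎_; inj₁; inj₂; [_,_]′)
open import Data.Empty using (⊥; ⊥-elim)
open import Function using (_∘_; id)
open import Function.Bundles using (_⇔_; mk⇔; Equivalence)
open import Relation.Binary.PropositionalEquality
open import Relation.Nullary using (¬_; yes; no; does; contradiction)
open import Relation.Nullary.Decidable using (¬?; decidable-stable)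

open ≡-Reasoning

-- Subsets of {0, …, m - 1} as increasing lists

elems′ : ∀ {m} → Subset m → List ℕ
elems′ []            = []
elems′ (inside  ∷ S) = 0 ∷ map suc (elems′ S)
elems′ (outside ∷ S) = map suc (elems′ S)

elems-∷ : ∀ {m} s (S : Subset m) →
  map toℕ (filter (_∈? s ∷ S) (tabulate fsuc)) ≡ map suc (elems S)
elems-∷ s S = begin
  map toℕ (filter (_∈? s ∷ S) (tabulate fsuc))
    ≡⟨ cong (map toℕ ∘ filter (_∈? s ∷ S)) (map-tabulate id fsuc) ⟨
  map toℕ (filter (_∈? s ∷ S) (map fsuc (allFin _)))
    ≡⟨ filter-fsuc (allFin _) ⟩
  map suc (elems S)
    ∎
  where
  filter-fsuc : ∀ is →
    map toℕ (filter (_∈? s ∷ S) (map fsuc is)) ≡ map suc (map toℕ (filter (_∈? S) is))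
  filter-fsuc []       = refl
  filter-fsuc (i ∷ is) with does (i ∈? S)
  ... | true  = cong (suc (toℕ i) ∷_) (filter-fsuc is)
  ... | false = filter-fsuc is

elems≡elems′ : ∀ {m} (S : Subset m) → elems S ≡ elems′ S
elems≡elems′ []            = refl
elems≡elems′ (inside  ∷ S) =
  cong (0 ∷_) (trans (elems-∷ inside S) (cong (map suc) (elems≡elems′ S)))
elems≡elems′ (outside ∷ S) = trans (elems-∷ outside S) (cong (map suc) (elems≡elems′ S))

length-elems′ : ∀ {m} (S : Subset m) → length (elems′ S) ≡ ∣ S ∣
length-elems′ []            = refl
length-elems′ (inside  ∷ S) = cong suc (trans (length-map suc (elems′ S)) (length-elems′ S))
length-elems′ (outside ∷ S) = trans (length-map suc (elems′ S)) (length-elems′ S)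

map-suc-increasing : ∀ {xs} → AllPairs _<_ xs → AllPairs _<_ (map suc xs)
map-suc-increasing = AllPairsₚ.map⁺ ∘ AllPairs.map s<s

map-suc-increasing⁻ : ∀ {xs} → AllPairs _<_ (map suc xs) → AllPairs _<_ xs
map-suc-increasing⁻ = AllPairs.map s<s⁻¹ ∘ AllPairsₚ.map⁻

map-suc-bounded⁻ : ∀ {m xs} → All (_< suc m) (map suc xs) → All (_< m) xs
map-suc-bounded⁻ = All.map s<s⁻¹ ∘ Allₚ.map⁻

elems′-increasing : ∀ {m} (S : Subset m) → AllPairs _<_ (elems′ S)
elems′-increasing []            = []
elems′-increasing (inside  ∷ S) =
  Allₚ.map⁺ (All.universal (λ _ → z<s) (elems′ S)) ∷ map-suc-increasing (elems′-increasing S)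
elems′-increasing (outside ∷ S) = map-suc-increasing (elems′-increasing S)

elems′-bounded : ∀ {m} (S : Subset m) → All (_< m) (elems′ S)
elems′-bounded []            = []
elems′-bounded (inside  ∷ S) = z<s ∷ Allₚ.map⁺ (All.map s<s (elems′-bounded S))
elems′-bounded (outside ∷ S) = Allₚ.map⁺ (All.map s<s (elems′-bounded S))

-- Only meaningful on increasing lists, where 0 can occur only at the head.
toSubset : ∀ {m} → List ℕ → Subset m
toSubset {zero}  _           = []
toSubset {suc m} (zero ∷ xs) = inside  ∷ toSubset (map pred xs)
toSubset {suc m} xs          = outside ∷ toSubset (map pred xs)

map-pred-suc : ∀ xs → map pred (map suc xs) ≡ xs
map-pred-suc xs = trans (sym (map-∘ xs)) (map-id xs)

toSubset-0∷ : ∀ {m} xs → toSubset {suc m} (0 ∷ map suc xs) ≡ inside ∷ toSubset xs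
toSubset-0∷ xs = cong (λ ys → inside ∷ toSubset ys) (map-pred-suc xs)

toSubset-map-suc : ∀ {m} xs → toSubset {suc m} (map suc xs) ≡ outside ∷ toSubset xs
toSubset-map-suc []       = refl
toSubset-map-suc (x ∷ xs) = cong (λ ys → outside ∷ toSubset ys) (map-pred-suc (x ∷ xs))

toSubset-elems′ : ∀ {m} (S : Subset m) → toSubset (elems′ S) ≡ S
toSubset-elems′ []            = refl
toSubset-elems′ (inside  ∷ S) =
  trans (toSubset-0∷ (elems′ S)) (cong (inside ∷_) (toSubset-elems′ S))
toSubset-elems′ (outside ∷ S) =
  trans (toSubset-map-suc (elems′ S)) (cong (outside ∷_) (toSubset-elems′ S))

map-suc-pred : ∀ {xs} → All (0 <_) xs → map suc (map pred xs) ≡ xs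
map-suc-pred {xs} 0<xs =
  trans (sym (map-∘ xs)) (map-id-local (All.map (λ { z<s → refl }) 0<xs))

increasing-view : ∀ {xs} → AllPairs _<_ xs →
  (∃[ ys ] xs ≡ map suc ys) ⊎ (∃[ ys ] xs ≡ 0 ∷ map suc ys)
increasing-view {[]}         _          = inj₁ ([] , refl)
increasing-view {zero ∷ xs}  (0<xs ∷ _) =
  inj₂ (map pred xs , cong (0 ∷_) (sym (map-suc-pred 0<xs)))
increasing-view {suc x ∷ xs} (x<xs ∷ _) =
  inj₁ (map pred (suc x ∷ xs) , sym (map-suc-pred (z<s ∷ All.map (<-trans z<s) x<xs)))

elems′-toSubset : ∀ {m xs} → AllPairs _<_ xs → All (_< m) xs → elems′ (toSubset {m} xs) ≡ xs
elems′-toSubset {zero}  {[]}    _ _        = refl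
elems′-toSubset {zero}  {_ ∷ _} _ (() ∷ _)
elems′-toSubset {suc m} xs< xs<m with increasing-view xs<
... | inj₁ (ys , refl) = begin
  elems′ (toSubset {suc m} (map suc ys))
    ≡⟨ cong elems′ (toSubset-map-suc {m} ys) ⟩
  map suc (elems′ (toSubset {m} ys))
    ≡⟨ cong (map suc) (elems′-toSubset (map-suc-increasing⁻ xs<) (map-suc-bounded⁻ xs<m)) ⟩
  map suc ys
    ∎
... | inj₂ (ys , refl) with xs< | xs<m
... | _ ∷ ys< | _ ∷ ys<m = begin
  elems′ (toSubset {suc m} (0 ∷ map suc ys))
    ≡⟨ cong elems′ (toSubset-0∷ {m} ys) ⟩
  0 ∷ map suc (elems′ (toSubset {m} ys))
    ≡⟨ cong (λ zs → 0 ∷ map suc zs)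
            (elems′-toSubset (map-suc-increasing⁻ ys<) (map-suc-bounded⁻ ys<m)) ⟩
  0 ∷ map suc ys
    ∎

IncreasingAtom : ℕ → ℕ → List ℕ → Set
IncreasingAtom n k xs = AllPairs _<_ xs × All (_≤ n) xs × length xs ≡ k × IsAtom xs

alphaIs-byEnumeration : ∀ {n k} (G : List (List ℕ)) → Unique G →
  (∀ xs → xs ∈ G ⇔ IncreasingAtom n k xs) → AlphaIs n k (length G)
alphaIs-byEnumeration {n} {k} G G! G-spec =
  map toSubset G , toSubset-G! , length-map toSubset G , λ S → mk⇔ (sound S) (complete S)
  where
  elems′-toSubset-G : ∀ {xs} → xs ∈ G → elems′ (toSubset {suc n} xs) ≡ xs
  elems′-toSubset-G xs∈G =
    let xs< , xs≤n , _ = Equivalence.to (G-spec _) xs∈G in elems′-toSubset xs< (All.map s≤s xs≤n)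

  toSubset-G! : Unique (map (toSubset {suc n}) G)
  toSubset-G! = Uniqueₚ.map⁻ (subst Unique (sym round-trip) G!)
    where
    round-trip : map elems′ (map (toSubset {suc n}) G) ≡ G
    round-trip = trans (sym (map-∘ G)) (map-id-local (All.tabulate elems′-toSubset-G))

  sound : ∀ S → S ∈ map toSubset G → IsAtom (elems S) × ∣ S ∣ ≡ k
  sound S S∈ with ∈-map⁻ toSubset S∈
  ... | xs , xs∈G , refl =
    let _ , _ , length≡k , atom = Equivalence.to (G-spec xs) xs∈G
        elems≡xs = trans (elems≡elems′ (toSubset xs)) (elems′-toSubset-G xs∈G)
    in subst IsAtom (sym elems≡xs) atom ,
       trans (sym (length-elems′ (toSubset {suc n} xs)))
             (trans (cong length (elems′-toSubset-G xs∈G)) length≡k)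

  complete : ∀ S → IsAtom (elems S) × ∣ S ∣ ≡ k → S ∈ map toSubset G
  complete S (atom , ∣S∣≡k) = subst (_∈ map toSubset G) (toSubset-elems′ S)
    (∈-map⁺ toSubset (Equivalence.from (G-spec _)
      ( elems′-increasing S , All.map s≤s⁻¹ (elems′-bounded S)
      , trans (length-elems′ S) ∣S∣≡k , subst IsAtom (elems≡elems′ S) atom)))

-- Atoms

∈-⊕⁺ : ∀ {X Y u v} → u ∈ X → v ∈ Y → u + v ∈ X ⊕ Y
∈-⊕⁺ {Y = Y} {u} u∈X v∈Y =
  ∈-concatMap⁺ (λ b → map (b +_) Y) (lose u∈X (∈-map⁺ (u +_) v∈Y))

∈-⊕⁻ : ∀ {X Y z} → z ∈ X ⊕ Y → ∃₂ λ u v → u ∈ X × v ∈ Y × u + v ≡ z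
∈-⊕⁻ {X} {Y} z∈X⊕Y with find (∈-concatMap⁻ (λ b → map (b +_) Y) {X} z∈X⊕Y)
... | u , u∈X , z∈u+Y with ∈-map⁻ (u +_) z∈u+Y
... | v , v∈Y , refl = u , v , u∈X , v∈Y , refl

Nontrivial : List ℕ → Set
Nontrivial X = ∃[ x ] x ∈ X × x ≢ 0

nontrivial⇒≉𝟎 : ∀ {X} → Nontrivial X → ¬ X ≐ 𝟎
nontrivial⇒≉𝟎 (x , x∈X , x≢0) X≐𝟎 with Equivalence.to (X≐𝟎 x) x∈X
... | here x≡0 = x≢0 x≡0

≐𝟎⊎nontrivial : ∀ {X} → 0 ∈ X → X ≐ 𝟎 ⊎ Nontrivial X
≐𝟎⊎nontrivial {X} 0∈X with any? (λ x → ¬? (x ≟ 0)) X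
... | yes ∃x≢0 = inj₂ (find ∃x≢0)
... | no ∄x≢0  = inj₁ λ x → mk⇔
  (λ x∈X → here (decidable-stable (x ≟ 0) (∄x≢0 ∘ lose x∈X)))
  (λ { (here refl) → 0∈X })

record Splitting (A X Y : List ℕ) : Set where
  field
    0∈X   : 0 ∈ X
    0∈Y   : 0 ∈ Y
    sum∈A : ∀ {u v} → u ∈ X → v ∈ Y → u + v ∈ A
    split : ∀ {z} → z ∈ A → ∃₂ λ u v → u ∈ X × v ∈ Y × u + v ≡ z

  X⊆A : ∀ {u} → u ∈ X → u ∈ A
  X⊆A {u} u∈X = subst (_∈ A) (+-identityʳ u) (sum∈A u∈X 0∈Y)

  Y⊆A : ∀ {v} → v ∈ Y → v ∈ A
  Y⊆A = sum∈A 0∈X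

splitting : ∀ {A X Y} → 0 ∈ X → 0 ∈ Y → A ≐ (X ⊕ Y) → Splitting A X Y
splitting 0∈X 0∈Y A≐X⊕Y = record
  { 0∈X   = 0∈X
  ; 0∈Y   = 0∈Y
  ; sum∈A = λ u∈X v∈Y → Equivalence.from (A≐X⊕Y _) (∈-⊕⁺ u∈X v∈Y)
  ; split = λ z∈A → ∈-⊕⁻ (Equivalence.to (A≐X⊕Y _) z∈A)
  }

Splitting-swap : ∀ {A X Y} → Splitting A X Y → Splitting A Y X
Splitting-swap {A} s = record
  { 0∈X   = 0∈Y
  ; 0∈Y   = 0∈X
  ; sum∈A = λ {u} {v} u∈Y v∈X → subst (_∈ A) (+-comm v u) (sum∈A v∈X u∈Y)
  ; split = λ z∈A → let u , v , u∈X , v∈Y , u+v≡z = split z∈A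
                    in v , u , v∈Y , u∈X , trans (+-comm v u) u+v≡z
  }
  where open Splitting s

least∈X⊎Y : ∀ {A X Y a} → Splitting A X Y →
  0 < a → a ∈ A → (∀ {x} → x ∈ A → x ≢ 0 → a ≤ x) → a ∈ X ⊎ a ∈ Y
least∈X⊎Y s 0<a a∈A least with Splitting.split s a∈A
... | u , v , u∈X , v∈Y , u+v≡a with u ≟ 0 | v ≟ 0
... | yes refl | _        = inj₂ (subst (_∈ _) u+v≡a v∈Y)
... | no _     | yes refl = inj₁ (subst (_∈ _) (trans (sym (+-identityʳ u)) u+v≡a) u∈X)
... | no u≢0   | no v≢0   = contradiction (sym u+v≡a)
  (<⇒≢ (≤-<-trans (least (Splitting.X⊆A s u∈X) u≢0) (m<m+n u (n≢0⇒n>0 v≢0))))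

-- Up to swapping the summands, the least positive element a of A lies in the first one.
isAtom-byLeast : ∀ {A a} → 0 ∈ A →
  0 < a → a ∈ A → (∀ {x} → x ∈ A → x ≢ 0 → a ≤ x) →
  (∀ {X Y} → Splitting A X Y → a ∈ X → Nontrivial Y → ⊥) → IsAtom A
isAtom-byLeast 0∈A 0<a a∈A least absurd =
  0∈A , nontrivial⇒≉𝟎 (_ , a∈A , >⇒≢ 0<a) , indecomposable
  where
  both-nontrivial : ∀ {X Y} → Splitting _ X Y → Nontrivial X → Nontrivial Y → ⊥
  both-nontrivial s X* Y* =
    [ (λ a∈X → absurd s a∈X Y*) , (λ a∈Y → absurd (Splitting-swap s) a∈Y X*) ]′
      (least∈X⊎Y s 0<a a∈A least)

  indecomposable : ∀ X Y → 0 ∈ X → 0 ∈ Y → _ ≐ (X ⊕ Y) → X ≐ 𝟎 ⊎ Y ≐ 𝟎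
  indecomposable X Y 0∈X 0∈Y A≐X⊕Y with ≐𝟎⊎nontrivial 0∈X | ≐𝟎⊎nontrivial 0∈Y
  ... | inj₁ X≐𝟎 | _        = inj₁ X≐𝟎
  ... | inj₂ _   | inj₁ Y≐𝟎 = inj₂ Y≐𝟎
  ... | inj₂ X*  | inj₂ Y*  = ⊥-elim (both-nontrivial (splitting 0∈X 0∈Y A≐X⊕Y) X* Y*)

¬isAtom : ∀ {A X Y} → 0 ∈ X → 0 ∈ Y → Nontrivial X → Nontrivial Y →
  A ≐ (X ⊕ Y) → ¬ IsAtom A
¬isAtom 0∈X 0∈Y X* Y* A≐X⊕Y (_ , _ , indecomposable) =
  [ nontrivial⇒≉𝟎 X* , nontrivial⇒≉𝟎 Y* ]′ (indecomposable _ _ 0∈X 0∈Y A≐X⊕Y)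

∉-above : ∀ {A c x} → All (_≤ c) A → c < x → x ∉ A
∉-above A≤c c<x x∈A = <⇒≱ c<x (All.lookup A≤c x∈A)

m+n≢m : ∀ m {n} → 0 < n → m + n ≢ m
m+n≢m m 0<n m+n≡m = <⇒≢ (m<m+n m 0<n) (sym m+n≡m)

isAtom-0ab : ∀ {a b} → 0 < a → a < b → a + a ≢ b → IsAtom (0 ∷ a ∷ b ∷ [])
isAtom-0ab {a} {b} 0<a a<b a+a≢b =
  isAtom-byLeast (here refl) 0<a (there (here refl)) least absurd
  where
  A : List ℕ
  A = 0 ∷ a ∷ b ∷ []

  least : ∀ {x} → x ∈ A → x ≢ 0 → a ≤ x
  least (here refl)                 x≢0 = contradiction refl x≢0
  least (there (here refl))         _   = ≤-refl
  least (there (there (here refl))) _   = <⇒≤ a<b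

  a+a∉A : a + a ∉ A
  a+a∉A (here a+a≡0)                 = >⇒≢ 0<a (m+n≡0⇒m≡0 a a+a≡0)
  a+a∉A (there (here a+a≡a))         = m+n≢m a 0<a a+a≡a
  a+a∉A (there (there (here a+a≡b))) = a+a≢b a+a≡b

  absurd : ∀ {X Y} → Splitting A X Y → a ∈ X → Nontrivial Y → ⊥
  absurd s a∈X (y , y∈Y , y≢0) with Splitting.Y⊆A s y∈Y | Splitting.sum∈A s a∈X y∈Y
  ... | here refl                 | _     = y≢0 refl
  ... | there (here refl)         | a+a∈A = a+a∉A a+a∈A
  ... | there (there (here refl)) | a+b∈A =
    ∉-above (z≤n ∷ <⇒≤ a<b ∷ ≤-refl ∷ []) (m<n+m b 0<a) a+b∈A

¬isAtom-0a2a : ∀ {a} → 0 < a → ¬ IsAtom (0 ∷ a ∷ a + a ∷ [])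
¬isAtom-0a2a {a} 0<a = ¬isAtom (here refl) (here refl) 0a* 0a* (λ x → mk⇔ to from)
  where
  0a* : Nontrivial (0 ∷ a ∷ [])
  0a* = a , there (here refl) , >⇒≢ 0<a

  to : ∀ {x} → x ∈ 0 ∷ a ∷ a + a ∷ [] → x ∈ (0 ∷ a ∷ []) ⊕ (0 ∷ a ∷ [])
  to (here refl)                 = here refl
  to (there (here refl))         = there (here refl)
  to (there (there (here refl))) = there (there (there (here refl)))

  from : ∀ {x} → x ∈ (0 ∷ a ∷ []) ⊕ (0 ∷ a ∷ []) → x ∈ 0 ∷ a ∷ a + a ∷ []
  from (here refl)                         = here refl
  from (there (here refl))                 = there (here refl)
  from (there (there (here refl)))         = there (here (+-identityʳ a))
  from (there (there (there (here refl)))) = there (there (here refl))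

module _ {a b c : ℕ} (0<a : 0 < a) (a<b : a < b) (b<c : b < c) (a+b≢c : a + b ≢ c) where

  private
    A : List ℕ
    A = 0 ∷ a ∷ b ∷ c ∷ []

    a<c : a < c
    a<c = <-trans a<b b<c

    A≤c : All (_≤ c) A
    A≤c = z≤n ∷ <⇒≤ a<c ∷ <⇒≤ b<c ∷ ≤-refl ∷ []

    a+b∉A : a + b ∉ A
    a+b∉A (here a+b≡0)                         = >⇒≢ 0<a (m+n≡0⇒m≡0 a a+b≡0)
    a+b∉A (there (here a+b≡a))                 = m+n≢m a (<-trans 0<a a<b) a+b≡a
    a+b∉A (there (there (here a+b≡b)))         = m+n≢m b 0<a (trans (+-comm b a) a+b≡b)
    a+b∉A (there (there (there (here a+b≡c)))) = a+b≢c a+b≡c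

    a+c∉A : a + c ∉ A
    a+c∉A = ∉-above A≤c (m<n+m c 0<a)

  -- Y ⊆ {0, a}, so b is reached only as a + a, and then c not at all.
  splitting-0abc-absurd : ∀ {X Y} → Splitting A X Y → a ∈ X → Nontrivial Y → ⊥
  splitting-0abc-absurd {X} {Y} s a∈X (y , y∈Y , y≢0) = c-unreachable
    where
    open Splitting s

    Y⊆0a : ∀ {v} → v ∈ Y → v ≡ 0 ⊎ v ≡ a
    Y⊆0a v∈Y with Y⊆A v∈Y
    ... | here v≡0                          = inj₁ v≡0
    ... | there (here v≡a)                  = inj₂ v≡a
    ... | there (there (here refl))         = ⊥-elim (a+b∉A (sum∈A a∈X v∈Y))
    ... | there (there (there (here refl))) = ⊥-elim (a+c∉A (sum∈A a∈X v∈Y))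

    a∈Y : a ∈ Y
    a∈Y = [ (λ y≡0 → contradiction y≡0 y≢0) , (λ y≡a → subst (_∈ Y) y≡a y∈Y) ]′
            (Y⊆0a y∈Y)

    split-by-a : ∀ {z} → z ∈ A → z ∈ X ⊎ ∃[ u ] u ∈ A × u + a ≡ z
    split-by-a z∈A with split z∈A
    ... | u , v , u∈X , v∈Y , u+v≡z with Y⊆0a v∈Y
    ... | inj₁ refl = inj₁ (subst (_∈ X) (trans (sym (+-identityʳ u)) u+v≡z) u∈X)
    ... | inj₂ refl = inj₂ (u , X⊆A u∈X , u+v≡z)

    a+a≡b : a + a ≡ b
    a+a≡b with split-by-a {b} (there (there (here refl)))
    ... | inj₁ b∈X = ⊥-elim (a+b∉A (subst (_∈ A) (+-comm b a) (sum∈A b∈X a∈Y)))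
    ... | inj₂ (_ , here refl , a≡b)                           = contradiction a≡b (<⇒≢ a<b)
    ... | inj₂ (_ , there (here refl) , a+a≡b)                 = a+a≡b
    ... | inj₂ (_ , there (there (here refl)) , b+a≡b)         = contradiction b+a≡b (m+n≢m b 0<a)
    ... | inj₂ (_ , there (there (there (here refl))) , c+a≡b) =
      contradiction c+a≡b (>⇒≢ (<-trans b<c (m<m+n c 0<a)))

    c-unreachable : ⊥
    c-unreachable with split-by-a {c} (there (there (there (here refl))))
    ... | inj₁ c∈X = ∉-above A≤c (m<m+n c 0<a) (sum∈A c∈X a∈Y)
    ... | inj₂ (_ , here refl , a≡c)                           = <⇒≢ a<c a≡c
    ... | inj₂ (_ , there (here refl) , a+a≡c)                 = <⇒≢ b<c (trans (sym a+a≡b) a+a≡c)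
    ... | inj₂ (_ , there (there (here refl)) , b+a≡c)         = a+b≢c (trans (+-comm a b) b+a≡c)
    ... | inj₂ (_ , there (there (there (here refl))) , c+a≡c) = m+n≢m c 0<a c+a≡c

  isAtom-0abc : IsAtom A
  isAtom-0abc = isAtom-byLeast (here refl) 0<a (there (here refl)) least splitting-0abc-absurd
    where
    least : ∀ {x} → x ∈ A → x ≢ 0 → a ≤ x
    least (here refl)                         x≢0 = contradiction refl x≢0
    least (there (here refl))                 _   = ≤-refl
    least (there (there (here refl)))         _   = <⇒≤ a<b
    least (there (there (there (here refl)))) _   = <⇒≤ a<c

¬isAtom-0ab[a+b] : ∀ {a b} → 0 < a → 0 < b → ¬ IsAtom (0 ∷ a ∷ b ∷ a + b ∷ [])
¬isAtom-0ab[a+b] {a} {b} 0<a 0<b =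
  ¬isAtom (here refl) (here refl) 0a* 0b* (λ x → mk⇔ to from)
  where
  0a* : Nontrivial (0 ∷ a ∷ [])
  0a* = a , there (here refl) , >⇒≢ 0<a
  0b* : Nontrivial (0 ∷ b ∷ [])
  0b* = b , there (here refl) , >⇒≢ 0<b

  to : ∀ {x} → x ∈ 0 ∷ a ∷ b ∷ a + b ∷ [] → x ∈ (0 ∷ a ∷ []) ⊕ (0 ∷ b ∷ [])
  to (here refl)                         = here refl
  to (there (here refl))                 = there (there (here (sym (+-identityʳ a))))
  to (there (there (here refl)))         = there (here refl)
  to (there (there (there (here refl)))) = there (there (there (here refl)))

  from : ∀ {x} → x ∈ (0 ∷ a ∷ []) ⊕ (0 ∷ b ∷ []) → x ∈ 0 ∷ a ∷ b ∷ a + b ∷ []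
  from (here refl)                         = here refl
  from (there (here refl))                 = there (there (here refl))
  from (there (there (here refl)))         = there (here (+-identityʳ a))
  from (there (there (there (here refl)))) = there (there (there (here refl)))

-- Counting

positives : ℕ → List ℕ
positives m = map suc (downFrom m)

∈-positives⁺ : ∀ {a m} → 0 < a → a ≤ m → a ∈ positives m
∈-positives⁺ {suc a} _ a≤m = ∈-map⁺ suc (∈-downFrom⁺ a≤m)

∈-positives⁻ : ∀ {a m} → a ∈ positives m → 0 < a × a ≤ m
∈-positives⁻ a∈ with ∈-map⁻ suc a∈
... | _ , a-1∈ , refl = z<s , ∈-downFrom⁻ a-1∈

positives-unique : ∀ m → Unique (positives m)
positives-unique m = Uniqueₚ.map⁺ suc-injective (Uniqueₚ.downFrom⁺ m)

length-positives : ∀ m → length (positives m) ≡ m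
length-positives m = trans (length-map suc (downFrom m)) (length-downFrom m)

avoiding : (ℕ → ℕ) → ℕ → List ℕ → List ℕ
avoiding f c = filter (λ x → ¬? (f x ≟ c))

length-avoiding-miss : ∀ {f c xs} → (∀ {x} → x ∈ xs → f x ≢ c) →
  length (avoiding f c xs) ≡ length xs
length-avoiding-miss {f} {c} miss = cong length (filter-all (λ x → ¬? (f x ≟ c)) (All.tabulate miss))

length-avoiding-hit : ∀ {f c xs t} → Unique xs → t ∈ xs → f t ≡ c → (∀ {x} → f x ≡ c → x ≡ t) →
  suc (length (avoiding f c xs)) ≡ length xs
length-avoiding-hit {f} {c} {x ∷ xs} (x∉xs ∷ _) (here refl) ft≡c only-t
  rewrite filter-reject (λ x → ¬? (f x ≟ c)) {x} {xs} (λ fx≢c → fx≢c ft≡c) =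
  cong suc (length-avoiding-miss (λ y∈xs fy≡c → All.lookup x∉xs y∈xs (sym (only-t fy≡c))))
length-avoiding-hit {f} {c} {x ∷ xs} (x∉xs ∷ xs!) (there t∈xs) ft≡c only-t
  rewrite filter-accept (λ x → ¬? (f x ≟ c)) {x} {xs}
                        (λ fx≡c → All.lookup x∉xs t∈xs (only-t fx≡c)) =
  cong suc (length-avoiding-hit xs! t∈xs ft≡c only-t)

∈-concatMap-downFrom⁺ : ∀ {A : Set} {f : ℕ → List A} {n m z} →
  m < n → z ∈ f m → z ∈ concatMap f (downFrom n)
∈-concatMap-downFrom⁺ {f = f} m<n z∈fm = ∈-concatMap⁺ f (lose (∈-downFrom⁺ m<n) z∈fm)

∈-concatMap-downFrom⁻ : ∀ {A : Set} (f : ℕ → List A) n {z} →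
  z ∈ concatMap f (downFrom n) → ∃[ m ] m < n × z ∈ f m
∈-concatMap-downFrom⁻ f n z∈ with find (∈-concatMap⁻ f {downFrom n} z∈)
... | m , m∈ , z∈fm = m , ∈-downFrom⁻ m∈ , z∈fm

Unique-concatMap⁺ : ∀ {A B : Set} {f : A → List B} (key : B → A) →
  (∀ {x z} → z ∈ f x → key z ≡ x) → (∀ x → Unique (f x)) →
  ∀ {xs} → Unique xs → Unique (concatMap f xs)
Unique-concatMap⁺ {f = f} key key-f f! xs! =
  Uniqueₚ.concat⁺ (Allₚ.map⁺ (All.universal f! _)) (AllPairsₚ.map⁺ (AllPairs.map disjoint xs!))
  where
  disjoint : ∀ {x y} → x ≢ y → Disjoint (f x) (f y)
  disjoint x≢y (z∈fx , z∈fy) = x≢y (trans (sym (key-f z∈fx)) (key-f z∈fy))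

pascal₂ : ∀ n → n + n C 2 ≡ suc n C 2
pascal₂ n = trans (cong (_+ n C 2) (sym (nC1≡n n))) (nCk+nC[k+1]≡[n+1]C[k+1] n 1)

-- Row m has m entries less the f (suc m) ∸ f m excluded ones, and the exclusions telescope.
length-concatMap-downFrom : ∀ {A : Set} (r : ℕ → List A) (f : ℕ → ℕ) → f 0 ≡ 0 → ∀ j →
  (∀ {m} → m < j → length (r m) + f (suc m) ≡ m + f m) →
  length (concatMap r (downFrom j)) + f j ≡ j C 2
length-concatMap-downFrom r f f0≡0 zero    _   = f0≡0
length-concatMap-downFrom r f f0≡0 (suc j) row = begin
  length (r j ++ concatMap r (downFrom j)) + f (suc j)  ≡⟨ cong (_+ f (suc j)) (length-++ (r j)) ⟩
  (length (r j) + L) + f (suc j)                         ≡⟨ xy∙z≈xz∙y _ L (f (suc j)) ⟩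
  (length (r j) + f (suc j)) + L                         ≡⟨ cong (_+ L) (row (n<1+n j)) ⟩
  (j + f j) + L                                          ≡⟨ xy∙z≈x∙zy j (f j) L ⟩
  j + (L + f j)                                          ≡⟨ cong (j +_) rows-below-j ⟩
  j + j C 2                                              ≡⟨ pascal₂ j ⟩
  suc j C 2                                              ∎
  where
  L = length (concatMap r (downFrom j))
  rows-below-j = length-concatMap-downFrom r f f0≡0 j (row ∘ m<n⇒m<1+n)

data Parity : ℕ → Set where
  even : ∀ h → Parity (h + h)
  odd  : ∀ h → Parity (suc (h + h))

parity : ∀ n → Parity n
parity zero    = even 0
parity (suc n) with parity n
... | even h = odd h
... | odd h  = subst Parity (cong suc (+-suc h h)) (even (suc h))

⌊1+n+n/2⌋≡n : ∀ n → ⌊ suc (n + n) /2⌋ ≡ n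
⌊1+n+n/2⌋≡n n = sym (n≡⌈n+n/2⌉ n)

m+m≡n+n⇒m≡n : ∀ {m n} → m + m ≡ n + n → m ≡ n
m+m≡n+n⇒m≡n {m} {n} m+m≡n+n =
  trans (n≡⌊n+n/2⌋ m) (trans (cong ⌊_/2⌋ m+m≡n+n) (sym (n≡⌊n+n/2⌋ n)))

m+m≢1+n+n : ∀ m n → m + m ≢ suc (n + n)
m+m≢1+n+n m n m+m≡1+n+n
  with trans (n≡⌊n+n/2⌋ m) (trans (cong ⌊_/2⌋ m+m≡1+n+n) (⌊1+n+n/2⌋≡n n))
... | refl = 1+n≢n (sym m+m≡1+n+n)

⌈n/2⌉≤m⇒n≤m+m : ∀ {n m} → ⌈ n /2⌉ ≤ m → n ≤ m + m
⌈n/2⌉≤m⇒n≤m+m {n} ⌈n/2⌉≤m = subst (_≤ _) (⌊n/2⌋+⌈n/2⌉≡n n)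
  (≤-trans (+-monoˡ-≤ ⌈ n /2⌉ (⌊n/2⌋≤⌈n/2⌉ n)) (+-mono-≤ ⌈n/2⌉≤m ⌈n/2⌉≤m))

n≤m+m⇒⌈n/2⌉≤m : ∀ {n m} → n ≤ m + m → ⌈ n /2⌉ ≤ m
n≤m+m⇒⌈n/2⌉≤m {n} {m} n≤m+m =
  ≤-trans (⌈n/2⌉-mono n≤m+m) (≤-reflexive (sym (n≡⌈n+n/2⌉ m)))

⌊n/2⌋≡n∸⌈n/2⌉ : ∀ n → ⌊ n /2⌋ ≡ n ∸ ⌈ n /2⌉
⌊n/2⌋≡n∸⌈n/2⌉ n =
  trans (sym (m+n∸n≡m ⌊ n /2⌋ ⌈ n /2⌉)) (cong (_∸ ⌈ n /2⌉) (⌊n/2⌋+⌈n/2⌉≡n n))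

⌊n/2⌋≡n/2 : ∀ n → ⌊ n /2⌋ ≡ n / 2
⌊n/2⌋≡n/2 0             = refl
⌊n/2⌋≡n/2 1             = refl
⌊n/2⌋≡n/2 (suc (suc n)) =
  trans (cong suc (⌊n/2⌋≡n/2 n)) (sym (m/n≡1+[m∸n]/n {suc (suc n)} {2} (s≤s (s≤s z≤n))))

-- Enumerating the atoms of size 3 and 4

row₃ : ℕ → List ℕ
row₃ m = avoiding (λ a → a + a) (suc m) (positives m)

-- The one excluded a, when m is odd, is (m + 1) / 2.
length-row₃ : ∀ m → length (row₃ m) + ⌊ suc m /2⌋ ≡ m + ⌊ m /2⌋
length-row₃ m with parity m
... | even h = cong₂ _+_
  (trans (length-avoiding-miss {xs = positives m} (λ {a} _ → m+m≢1+n+n a h)) (length-positives m))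
  (trans (⌊1+n+n/2⌋≡n h) (n≡⌊n+n/2⌋ h))
... | odd h = begin
  length (row₃ m) + suc ⌊ h + h /2⌋    ≡⟨ +-suc (length (row₃ m)) _ ⟩
  suc (length (row₃ m)) + ⌊ h + h /2⌋  ≡⟨ cong₂ _+_ hit ⌊2h/2⌋≡⌊2h+1/2⌋ ⟩
  m + ⌊ m /2⌋                          ∎
  where
  ⌊2h/2⌋≡⌊2h+1/2⌋ : ⌊ h + h /2⌋ ≡ ⌊ suc (h + h) /2⌋
  ⌊2h/2⌋≡⌊2h+1/2⌋ = trans (sym (n≡⌊n+n/2⌋ h)) (sym (⌊1+n+n/2⌋≡n h))
  t+t≡1+m : suc h + suc h ≡ suc m
  t+t≡1+m = cong suc (+-suc h h)
  hit : suc (length (row₃ m)) ≡ m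
  hit = trans
    (length-avoiding-hit (positives-unique m) (∈-positives⁺ z<s (s≤s (m≤m+n h h))) t+t≡1+m
      (λ a+a≡1+m → m+m≡n+n⇒m≡n (trans a+a≡1+m (sym t+t≡1+m))))
    (length-positives m)

row₄ : ℕ → ℕ → List ℕ
row₄ k m = avoiding (_+ suc m) (suc k) (positives m)

-- The one excluded a, when ⌈k/2⌉ ≤ m, is k ∸ m.
length-row₄ : ∀ {k m} → m < k →
  length (row₄ k m) + (suc m ∸ ⌈ k /2⌉) ≡ m + (m ∸ ⌈ k /2⌉)
length-row₄ {k} {m} m<k with ⌈ k /2⌉ ≤? m
... | yes ⌈k/2⌉≤m = begin
  length (row₄ k m) + (suc m ∸ ⌈ k /2⌉)    ≡⟨ cong (length (row₄ k m) +_) (+-∸-assoc 1 ⌈k/2⌉≤m) ⟩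
  length (row₄ k m) + suc (m ∸ ⌈ k /2⌉)    ≡⟨ +-suc (length (row₄ k m)) _ ⟩
  suc (length (row₄ k m)) + (m ∸ ⌈ k /2⌉)  ≡⟨ cong (_+ (m ∸ ⌈ k /2⌉)) hit ⟩
  m + (m ∸ ⌈ k /2⌉)                        ∎
  where
  t+1+m≡1+k : (k ∸ m) + suc m ≡ suc k
  t+1+m≡1+k = trans (+-suc (k ∸ m) m) (cong suc (m∸n+n≡m (<⇒≤ m<k)))
  t∈ : k ∸ m ∈ positives m
  t∈ = ∈-positives⁺ (m<n⇒0<n∸m m<k) (m≤n+o⇒m∸n≤o k m (⌈n/2⌉≤m⇒n≤m+m ⌈k/2⌉≤m))
  hit : suc (length (row₄ k m)) ≡ m
  hit = trans
    (length-avoiding-hit (positives-unique m) t∈ t+1+m≡1+k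
      (λ {a} a+1+m≡1+k → +-cancelʳ-≡ (suc m) a (k ∸ m) (trans a+1+m≡1+k (sym t+1+m≡1+k))))
    (length-positives m)
... | no ⌈k/2⌉≰m = cong₂ _+_
  (trans (length-avoiding-miss {xs = positives m} miss) (length-positives m))
  (trans (m≤n⇒m∸n≡0 m<⌈k/2⌉) (sym (m≤n⇒m∸n≡0 (<⇒≤ m<⌈k/2⌉))))
  where
  m<⌈k/2⌉ = ≰⇒> ⌈k/2⌉≰m
  miss : ∀ {a} → a ∈ positives m → a + suc m ≢ suc k
  miss {a} a∈ a+1+m≡1+k = ⌈k/2⌉≰m (n≤m+m⇒⌈n/2⌉≤m (≤-trans
    (≤-reflexive (suc-injective (trans (sym a+1+m≡1+k) (+-suc a m))))
    (+-monoˡ-≤ m (proj₂ (∈-positives⁻ a∈)))))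

head≡0 : ∀ {x xs} → AllPairs _<_ (x ∷ xs) → 0 ∈ x ∷ xs → x ≡ 0
head≡0 _          (here 0≡x)   = sym 0≡x
head≡0 (x<xs ∷ _) (there 0∈xs) = contradiction (All.lookup x<xs 0∈xs) n≮0

atoms₃-top : ℕ → List (List ℕ)
atoms₃-top m = map (λ a → 0 ∷ a ∷ suc m ∷ []) (row₃ m)

atoms₃ : ℕ → List (List ℕ)
atoms₃ n = concatMap atoms₃-top (downFrom n)

∈-atoms₃⁺ : ∀ {n a b} → 0 < a → a < b → b ≤ n → a + a ≢ b →
  (0 ∷ a ∷ b ∷ []) ∈ atoms₃ n
∈-atoms₃⁺ {b = suc m} 0<a (s≤s a≤m) b≤n a+a≢b =
  ∈-concatMap-downFrom⁺ b≤n (∈-map⁺ _ (∈-filter⁺ _ (∈-positives⁺ 0<a a≤m) a+a≢b))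

∈-atoms₃⁻ : ∀ {n xs} → xs ∈ atoms₃ n →
  ∃₂ λ a b → xs ≡ 0 ∷ a ∷ b ∷ [] × 0 < a × a < b × b ≤ n × a + a ≢ b
∈-atoms₃⁻ {n} xs∈ with ∈-concatMap-downFrom⁻ atoms₃-top n xs∈
... | m , m<n , xs∈top with ∈-map⁻ (λ a → 0 ∷ a ∷ suc m ∷ []) xs∈top
... | a , a∈row , refl with ∈-filter⁻ _ a∈row
... | a∈ , a+a≢b =
  let 0<a , a≤m = ∈-positives⁻ a∈ in a , suc m , refl , 0<a , s≤s a≤m , m<n , a+a≢b

atoms₃-unique : ∀ n → Unique (atoms₃ n)
atoms₃-unique n = Unique-concatMap⁺ key key-top
  (λ m → Uniqueₚ.map⁺ (∷-injectiveˡ ∘ ∷-injectiveʳ) (Uniqueₚ.filter⁺ _ (positives-unique m)))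
  (Uniqueₚ.downFrom⁺ n)
  where
  key : List ℕ → ℕ
  key (_ ∷ _ ∷ b ∷ _) = pred b
  key _               = 0
  key-top : ∀ {m xs} → xs ∈ atoms₃-top m → key xs ≡ m
  key-top {m} xs∈ with ∈-map⁻ (λ a → 0 ∷ a ∷ suc m ∷ []) xs∈
  ... | _ , _ , refl = refl

length-atoms₃ : ∀ n → length (atoms₃ n) + ⌊ n /2⌋ ≡ n C 2
length-atoms₃ n = length-concatMap-downFrom atoms₃-top ⌊_/2⌋ refl n
  (λ {m} _ → trans (cong (_+ ⌊ suc m /2⌋) (length-map _ (row₃ m))) (length-row₃ m))

atoms₃-spec : ∀ n xs → xs ∈ atoms₃ n ⇔ IncreasingAtom n 3 xs
atoms₃-spec n xs = mk⇔ sound complete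
  where
  sound : ∀ {xs} → xs ∈ atoms₃ n → IncreasingAtom n 3 xs
  sound xs∈ with ∈-atoms₃⁻ {n} xs∈
  ... | a , b , refl , 0<a , a<b , b≤n , a+a≢b =
    ((0<a ∷ <-trans 0<a a<b ∷ []) ∷ (a<b ∷ []) ∷ [] ∷ []) ,
    (z≤n ∷ ≤-trans (<⇒≤ a<b) b≤n ∷ b≤n ∷ []) , refl , isAtom-0ab 0<a a<b a+a≢b

  complete : ∀ {xs} → IncreasingAtom n 3 xs → xs ∈ atoms₃ n
  complete {[]}                (_ , _ , () , _)
  complete {_ ∷ []}            (_ , _ , () , _)
  complete {_ ∷ _ ∷ []}        (_ , _ , () , _)
  complete {_ ∷ _ ∷ _ ∷ _ ∷ _} (_ , _ , () , _)
  complete {x ∷ a ∷ b ∷ []}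
    (xs<@((x<a ∷ _) ∷ (a<b ∷ []) ∷ [] ∷ []) , (_ ∷ _ ∷ b≤n ∷ []) , refl , atom)
    with head≡0 xs< (proj₁ atom)
  ... | refl = ∈-atoms₃⁺ {n} x<a a<b b≤n
    (λ a+a≡b → ¬isAtom-0a2a x<a (subst (λ b → IsAtom (0 ∷ a ∷ b ∷ [])) (sym a+a≡b) atom))

atoms₄-top : ℕ → ℕ → List (List ℕ)
atoms₄-top k m = map (λ a → 0 ∷ a ∷ suc m ∷ suc k ∷ []) (row₄ k m)

atoms₄-max : ℕ → List (List ℕ)
atoms₄-max k = concatMap (atoms₄-top k) (downFrom k)

atoms₄ : ℕ → List (List ℕ)
atoms₄ n = concatMap atoms₄-max (downFrom n)

∈-atoms₄⁺ : ∀ {n a b c} → 0 < a → a < b → b < c → c ≤ n → a + b ≢ c →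
  (0 ∷ a ∷ b ∷ c ∷ []) ∈ atoms₄ n
∈-atoms₄⁺ {b = suc m} {suc k} 0<a (s≤s a≤m) (s≤s m<k) c≤n a+b≢c =
  ∈-concatMap-downFrom⁺ c≤n (∈-concatMap-downFrom⁺ m<k
    (∈-map⁺ _ (∈-filter⁺ _ (∈-positives⁺ 0<a a≤m) a+b≢c)))

∈-atoms₄⁻ : ∀ {n xs} → xs ∈ atoms₄ n →
  ∃₂ λ a b → ∃[ c ] xs ≡ 0 ∷ a ∷ b ∷ c ∷ [] ×
                     0 < a × a < b × b < c × c ≤ n × a + b ≢ c
∈-atoms₄⁻ {n} xs∈ with ∈-concatMap-downFrom⁻ atoms₄-max n xs∈
... | k , k<n , xs∈max with ∈-concatMap-downFrom⁻ (atoms₄-top k) k xs∈max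
... | m , m<k , xs∈top with ∈-map⁻ (λ a → 0 ∷ a ∷ suc m ∷ suc k ∷ []) xs∈top
... | a , a∈row , refl with ∈-filter⁻ _ a∈row
... | a∈ , a+b≢c = let 0<a , a≤m = ∈-positives⁻ a∈ in
  a , suc m , suc k , refl , 0<a , s≤s a≤m , s≤s m<k , k<n , a+b≢c

atoms₄-unique : ∀ n → Unique (atoms₄ n)
atoms₄-unique n = Unique-concatMap⁺ key₄ key₄-max atoms₄-max-unique (Uniqueₚ.downFrom⁺ n)
  where
  key₃ key₄ : List ℕ → ℕ
  key₃ (_ ∷ _ ∷ b ∷ _)     = pred b
  key₃ _                   = 0
  key₄ (_ ∷ _ ∷ _ ∷ c ∷ _) = pred c
  key₄ _                   = 0

  keys-top : ∀ {k m xs} → xs ∈ atoms₄-top k m → key₃ xs ≡ m × key₄ xs ≡ k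
  keys-top {k} {m} xs∈ with ∈-map⁻ (λ a → 0 ∷ a ∷ suc m ∷ suc k ∷ []) xs∈
  ... | _ , _ , refl = refl , refl

  atoms₄-max-unique : ∀ k → Unique (atoms₄-max k)
  atoms₄-max-unique k = Unique-concatMap⁺ key₃ (proj₁ ∘ keys-top)
    (λ m → Uniqueₚ.map⁺ (∷-injectiveˡ ∘ ∷-injectiveʳ) (Uniqueₚ.filter⁺ _ (positives-unique m)))
    (Uniqueₚ.downFrom⁺ k)

  key₄-max : ∀ {k xs} → xs ∈ atoms₄-max k → key₄ xs ≡ k
  key₄-max {k} xs∈ = let _ , _ , xs∈top = ∈-concatMap-downFrom⁻ (atoms₄-top k) k xs∈
                     in proj₂ (keys-top xs∈top)

length-atoms₄-max : ∀ k → length (atoms₄-max k) + ⌊ k /2⌋ ≡ k C 2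
length-atoms₄-max k = trans (cong (length (atoms₄-max k) +_) (⌊n/2⌋≡n∸⌈n/2⌉ k))
  (length-concatMap-downFrom (atoms₄-top k) (_∸ ⌈ k /2⌉) (0∸n≡0 ⌈ k /2⌉) k
    (λ {m} m<k → trans (cong (_+ (suc m ∸ ⌈ k /2⌉)) (length-map _ (row₄ k m)))
                       (length-row₄ m<k)))

length-atoms₄ : ∀ n → 2 * length (atoms₄ n) + n C 2 ≡ 2 * (n C 3) + ⌊ n /2⌋
length-atoms₄ zero    = refl
length-atoms₄ (suc n) = begin
  2 * length (atoms₄-max n ++ atoms₄ n) + suc n C 2
    ≡⟨ cong₂ (λ l C₂ → 2 * l + C₂) (length-++ (atoms₄-max n)) (sym (pascal₂ n)) ⟩
  2 * (M + L) + (n + n C 2)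
    ≡⟨ cong (λ k → 2 * (M + L) + (k + n C 2)) (sym (⌊n/2⌋+⌈n/2⌉≡n n)) ⟩
  2 * (M + L) + ((h + h′) + n C 2)
    ≡⟨ rearrange₁ M L h h′ (n C 2) ⟩
  (2 * L + n C 2) + (2 * M + h + h′)
    ≡⟨ cong (_+ (2 * M + h + h′)) (length-atoms₄ n) ⟩
  (2 * (n C 3) + h) + (2 * M + h + h′)
    ≡⟨ rearrange₂ (n C 3) h M h′ ⟩
  2 * ((M + h) + n C 3) + h′
    ≡⟨ cong (λ C₂ → 2 * (C₂ + n C 3) + h′) (length-atoms₄-max n) ⟩
  2 * (n C 2 + n C 3) + h′
    ≡⟨ cong (λ C₃ → 2 * C₃ + h′) (nCk+nC[k+1]≡[n+1]C[k+1] n 2) ⟩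
  2 * (suc n C 3) + ⌊ suc n /2⌋
    ∎
  where
  M = length (atoms₄-max n)
  L = length (atoms₄ n)
  h = ⌊ n /2⌋
  h′ = ⌈ n /2⌉
  rearrange₁ : ∀ M L h h′ C₂ →
    2 * (M + L) + ((h + h′) + C₂) ≡ (2 * L + C₂) + (2 * M + h + h′)
  rearrange₁ = solve-∀
  rearrange₂ : ∀ C₃ h M h′ → (2 * C₃ + h) + (2 * M + h + h′) ≡ 2 * ((M + h) + C₃) + h′
  rearrange₂ = solve-∀

atoms₄-spec : ∀ n xs → xs ∈ atoms₄ n ⇔ IncreasingAtom n 4 xs
atoms₄-spec n xs = mk⇔ sound complete
  where
  sound : ∀ {xs} → xs ∈ atoms₄ n → IncreasingAtom n 4 xs
  sound xs∈ with ∈-atoms₄⁻ {n} xs∈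
  ... | a , b , c , refl , 0<a , a<b , b<c , c≤n , a+b≢c =
    ((0<a ∷ 0<b ∷ <-trans 0<b b<c ∷ []) ∷ (a<b ∷ a<c ∷ []) ∷ (b<c ∷ []) ∷ [] ∷ []) ,
    (z≤n ∷ ≤-trans (<⇒≤ a<c) c≤n ∷ ≤-trans (<⇒≤ b<c) c≤n ∷ c≤n ∷ []) ,
    refl , isAtom-0abc 0<a a<b b<c a+b≢c
    where
    0<b = <-trans 0<a a<b
    a<c = <-trans a<b b<c

  complete : ∀ {xs} → IncreasingAtom n 4 xs → xs ∈ atoms₄ n
  complete {[]}                    (_ , _ , () , _)
  complete {_ ∷ []}                (_ , _ , () , _)
  complete {_ ∷ _ ∷ []}            (_ , _ , () , _)
  complete {_ ∷ _ ∷ _ ∷ []}        (_ , _ , () , _)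
  complete {_ ∷ _ ∷ _ ∷ _ ∷ _ ∷ _} (_ , _ , () , _)
  complete {x ∷ a ∷ b ∷ c ∷ []}
    ( xs<@((x<a ∷ x<b ∷ _) ∷ (a<b ∷ _) ∷ (b<c ∷ []) ∷ [] ∷ [])
    , (_ ∷ _ ∷ _ ∷ c≤n ∷ []) , refl , atom)
    with head≡0 xs< (proj₁ atom)
  ... | refl = ∈-atoms₄⁺ {n} x<a a<b b<c c≤n
    (λ a+b≡c → ¬isAtom-0ab[a+b] x<a x<b
                 (subst (λ c → IsAtom (0 ∷ a ∷ b ∷ c ∷ [])) (sym a+b≡c) atom))

proposition4p2 : (n : ℕ) → 1 ≤ n →
    (Σ ℕ λ a → AlphaIs n 3 a × a + n / 2 ≡ n C 2) ×
    (Σ ℕ λ b → AlphaIs n 4 b × 2 * b + n C 2 ≡ 2 * (n C 3) + n / 2)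
proposition4p2 n _ =
  (length (atoms₃ n) ,
    alphaIs-byEnumeration (atoms₃ n) (atoms₃-unique n) (atoms₃-spec n) ,
    trans (cong (length (atoms₃ n) +_) (sym (⌊n/2⌋≡n/2 n))) (length-atoms₃ n)) ,
  (length (atoms₄ n) ,
    alphaIs-byEnumeration (atoms₄ n) (atoms₄-unique n) (atoms₄-spec n) ,
    trans (length-atoms₄ n) (cong (2 * (n C 3) +_) (⌊n/2⌋≡n/2 n)))
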